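{- For any positive integers $n,n_1,n_2$ with $n=n_1+n_2$, \[ M(n)\le M(n_1)+2^{n_1}M(n_2). \]
   Context: For a positive integer $m$, $M(m)$ denotes the maximum size of a union-free family of non-empty subsets of $[m]=\{1,\dots,m\}$, where a family is union-free if no member equals the union of one or more other members of the family. -}

module Defs where

open import Data.Nat using (ℕ; _≤_)
open import Data.List using (List; []; length)
open import Data.List.Membership.Propositional using (_∈_)
open import Data.List.Relation.Unary.All using (All)
open import Data.List.Relation.Unary.Unique.Propositional using (Unique)
open import Data.Fin.Subset using (Subset; ⋃; Nonempty)
open import Data.Product using (Σ; _×_; ∃)
open import Relation.Binary.PropositionalEquality using (_≡_; _≢_)

-- A family of subsets of [m] = Fin m is a duplicate-free list of subsets.
-- Union-free: no member A equals the union of one or more (≥ 1) other members.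
UnionFree : {m : ℕ} → List (Subset m) → Set
UnionFree {m} F =
  ∀ (A : Subset m) → A ∈ F →
  ∀ (G : List (Subset m)) → G ≢ [] →
  All (λ B → B ∈ F × B ≢ A) G → A ≢ ⋃ G

IsUnionFreeFamily : (m : ℕ) → List (Subset m) → Set
IsUnionFreeFamily m F = Unique F × All Nonempty F × UnionFree F

-- IsM m k  means  M(m) = k : k is the maximum size of such a family.
IsM : ℕ → ℕ → Set
IsM m k =
  (Σ (List (Subset m)) λ F → IsUnionFreeFamily m F × length F ≡ k)
  × (∀ (F : List (Subset m)) → IsUnionFreeFamily m F → length F ≤ k)

-- Split [n₁ + n₂] as [n₁] ⊔ [n₂] and write each member of a union-free family
-- F as S ++ T with S ⊆ [n₁], T ⊆ [n₂]. The sets S with S ++ ∅ ∈ F form a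
-- union-free family on [n₁], and for each of the 2^n₁ sets S the non-empty T
-- with S ++ T ∈ F form a union-free family on [n₂]: the embeddings S ↦ S ++ ∅
-- and T ↦ S ++ T are injective and commute with non-empty unions, so a union
-- relation in a piece would be one in F. Every member of F lies in exactly one
-- piece, hence |F| ≤ M(n₁) + 2^n₁ M(n₂).
module Submission where

open import Defs
open import Data.Nat using (ℕ; zero; suc; _+_; _*_; _^_; _≤_; _<_; z≤n; s≤s)
open import Data.Nat.Properties
  using (module ≤-Reasoning; ≤-refl; ≤-trans; n<1+n; n≤1+n; +-identityʳ;
         +-mono-≤; +-mono-<-≤; +-mono-≤-<)
open import Data.Nat.ListAction using (sum)
open import Data.Bool using (true; false) renaming (_≟_ to _≟ᴮ_)
open import Data.Unit using (tt)
open import Data.Empty using (⊥-elim)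
open import Data.Product as Product using (_×_; _,_)
open import Data.Sum using (_⊎_; inj₁; inj₂)
open import Data.Maybe using (Maybe; just; nothing; Is-just)
open import Data.Maybe.Relation.Unary.Any as MaybeAny using ()
open import Data.Maybe.Relation.Unary.All as MaybeAll using ()
open import Data.Vec using ([]; _∷_; _++_; take; drop; here; there)
open import Data.Vec.Properties using (≡-dec; zipWith-++; take++drop≡id; ++-injectiveˡ; ++-injectiveʳ)
open import Data.List as List using (List; []; _∷_; length; map; mapMaybe)
open import Data.List.Properties using (length-map; length-++)
open import Data.List.Membership.Propositional using (_∈_)
open import Data.List.Membership.Propositional.Properties using (∈-map⁺; ∈-++⁺ˡ; ∈-++⁺ʳ)
open import Data.List.Relation.Unary.Any as Any using (Any)
open import Data.List.Relation.Unary.All as All using (All)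
open import Data.List.Relation.Unary.All.Properties as All using ()
open import Data.List.Relation.Unary.AllPairs using ([]; _∷_)
open import Data.List.Relation.Unary.Unique.Propositional using (Unique)
open import Data.Fin using (zero; suc)
open import Data.Fin.Subset using (Subset; ⋃; Nonempty; Empty; _∪_; ⊥)
open import Data.Fin.Subset.Properties using (∉⊥; Empty-unique; nonempty?; ∪-idem; ∪-identityʳ)
open import Function using (_∘_)
open import Function.Definitions using (Injective)
open import Relation.Nullary using (Dec; yes; no)
open import Relation.Binary.PropositionalEquality
  using (_≡_; _≢_; refl; sym; trans; cong; cong₂; subst; module ≡-Reasoning)

Nonempty-++⊥⁻ : ∀ {a b} (s : Subset a) → Nonempty (s ++ ⊥ {b}) → Nonempty s
Nonempty-++⊥⁻ []         (_ , x∈⊥) = ⊥-elim (∉⊥ x∈⊥)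
Nonempty-++⊥⁻ (true ∷ s) _         = zero , here
Nonempty-++⊥⁻ (false ∷ s) (suc x , there x∈) =
  Product.map suc there (Nonempty-++⊥⁻ s (x , x∈))

⋃-map-++ˡ : ∀ {a b} (s : Subset a) (y : Subset b) G → ⋃ (map (s ++_) (y ∷ G)) ≡ s ++ ⋃ (y ∷ G)
⋃-map-++ˡ s y []      = trans (∪-identityʳ (s ++ y)) (cong (s ++_) (sym (∪-identityʳ y)))
⋃-map-++ˡ s y (z ∷ G) = begin
  (s ++ y) ∪ ⋃ (map (s ++_) (z ∷ G)) ≡⟨ cong ((s ++ y) ∪_) (⋃-map-++ˡ s z G) ⟩
  (s ++ y) ∪ (s ++ ⋃ (z ∷ G))         ≡⟨ zipWith-++ _ s y s (⋃ (z ∷ G)) ⟩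
  (s ∪ s) ++ ⋃ (y ∷ z ∷ G)            ≡⟨ cong (_++ ⋃ (y ∷ z ∷ G)) (∪-idem s) ⟩
  s ++ ⋃ (y ∷ z ∷ G)                  ∎
  where open ≡-Reasoning

⋃-map-++ʳ : ∀ {a b} (t : Subset b) (y : Subset a) G → ⋃ (map (_++ t) (y ∷ G)) ≡ ⋃ (y ∷ G) ++ t
⋃-map-++ʳ t y []      = trans (∪-identityʳ (y ++ t)) (cong (_++ t) (sym (∪-identityʳ y)))
⋃-map-++ʳ t y (z ∷ G) = begin
  (y ++ t) ∪ ⋃ (map (_++ t) (z ∷ G)) ≡⟨ cong ((y ++ t) ∪_) (⋃-map-++ʳ t z G) ⟩
  (y ++ t) ∪ (⋃ (z ∷ G) ++ t)         ≡⟨ zipWith-++ _ y t (⋃ (z ∷ G)) t ⟩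
  ⋃ (y ∷ z ∷ G) ++ (t ∪ t)            ≡⟨ cong (⋃ (y ∷ z ∷ G) ++_) (∪-idem t) ⟩
  ⋃ (y ∷ z ∷ G) ++ t                  ∎
  where open ≡-Reasoning

allSubsets : ∀ n → List (Subset n)
allSubsets zero    = [] ∷ []
allSubsets (suc n) = map (true ∷_) (allSubsets n) List.++ map (false ∷_) (allSubsets n)

∈-allSubsets : ∀ {n} (s : Subset n) → s ∈ allSubsets n
∈-allSubsets []          = Any.here refl
∈-allSubsets (true ∷ s)  = ∈-++⁺ˡ (∈-map⁺ (true ∷_) (∈-allSubsets s))
∈-allSubsets (false ∷ s) = ∈-++⁺ʳ (map (true ∷_) (allSubsets _)) (∈-map⁺ (false ∷_) (∈-allSubsets s))

length-allSubsets : ∀ n → length (allSubsets n) ≡ 2 ^ n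
length-allSubsets zero    = refl
length-allSubsets (suc n) = begin
  length (map (true ∷_) (allSubsets n) List.++ map (false ∷_) (allSubsets n))
    ≡⟨ length-++ (map (true ∷_) (allSubsets n)) ⟩
  length (map (true ∷_) (allSubsets n)) + length (map (false ∷_) (allSubsets n))
    ≡⟨ cong₂ _+_ (length-map _ (allSubsets n)) (length-map _ (allSubsets n)) ⟩
  length (allSubsets n) + length (allSubsets n)
    ≡⟨ cong₂ _+_ (length-allSubsets n) (length-allSubsets n) ⟩
  2 ^ n + 2 ^ n
    ≡⟨ cong (2 ^ n +_) (sym (+-identityʳ (2 ^ n))) ⟩
  2 ^ suc n ∎
  where open ≡-Reasoning

UnionFree-pullback : ∀ {m n} (f : Subset m → Subset n) → Injective _≡_ _≡_ f →
  (∀ y G → ⋃ (map f (y ∷ G)) ≡ f (⋃ (y ∷ G))) →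
  ∀ {E F} → (∀ {x} → x ∈ E → f x ∈ F) → UnionFree F → UnionFree E
UnionFree-pullback f inj pres mem ufF A A∈E []      G≢[] _    _     = G≢[] refl
UnionFree-pullback f inj pres mem ufF A A∈E (y ∷ G) _    allG A≡⋃G =
  ufF (f A) (mem A∈E) (map f (y ∷ G)) (λ ()) (All.map⁺ (All.map image allG))
      (trans (cong f A≡⋃G) (sym (pres y G)))
  where
  image : ∀ {B} → B ∈ _ × B ≢ A → f B ∈ _ × f B ≢ f A
  image (B∈E , B≢A) = mem B∈E , B≢A ∘ inj

module PartialInverse {A B : Set} (encode : B → A) (decode : A → Maybe B)
                      (decode-sound : ∀ {x y} → decode x ≡ just y → x ≡ encode y) where

  encode-∈ : ∀ xs {y} → y ∈ mapMaybe decode xs → encode y ∈ xs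
  encode-∈ (x ∷ xs) y∈ with decode x in eq
  ... | nothing = Any.there (encode-∈ xs y∈)
  ... | just _ with y∈
  ...   | Any.here refl = Any.here (sym (decode-sound eq))
  ...   | Any.there y∈′ = Any.there (encode-∈ xs y∈′)

  mapMaybe-unique : ∀ {xs} → Unique xs → Unique (mapMaybe decode xs)
  mapMaybe-unique {[]}     []          = []
  mapMaybe-unique {x ∷ xs} (x∉ ∷ uxs) with decode x in eq
  ... | nothing = mapMaybe-unique uxs
  ... | just y  = All.tabulate (λ y′∈ y≡y′ → All.lookup x∉ (encode-∈ xs y′∈)
                                   (trans (decode-sound eq) (cong encode y≡y′)))
                  ∷ mapMaybe-unique uxs

module _ {A B : Set} (d : A → Maybe B) (x : A) (xs : List A) where

  length-mapMaybe-∷-≤ : length (mapMaybe d xs) ≤ length (mapMaybe d (x ∷ xs))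
  length-mapMaybe-∷-≤ with d x
  ... | nothing = ≤-refl
  ... | just _  = n≤1+n _

  length-mapMaybe-∷-< : Is-just (d x) → length (mapMaybe d xs) < length (mapMaybe d (x ∷ xs))
  length-mapMaybe-∷-< j with d x
  ... | just _ = n<1+n _

module _ {I : Set} {f g : I → ℕ} (f≤g : ∀ i → f i ≤ g i) where

  sum-map-≤ : ∀ is → sum (map f is) ≤ sum (map g is)
  sum-map-≤ []       = z≤n
  sum-map-≤ (i ∷ is) = +-mono-≤ (f≤g i) (sum-map-≤ is)

  sum-map-< : ∀ {is} → Any (λ i → f i < g i) is → sum (map f is) < sum (map g is)
  sum-map-< {_ ∷ is} (Any.here fi<gi) = +-mono-<-≤ fi<gi (sum-map-≤ is)
  sum-map-< {i ∷ _}  (Any.there any)  = +-mono-≤-< (f≤g i) (sum-map-< any)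

sum-map-≤-length-* : ∀ {I : Set} {f : I → ℕ} {k} → (∀ i → f i ≤ k) →
  ∀ is → sum (map f is) ≤ length is * k
sum-map-≤-length-* f≤k []       = z≤n
sum-map-≤-length-* f≤k (i ∷ is) = +-mono-≤ (f≤k i) (sum-map-≤-length-* f≤k is)

module _ {A B C I : Set} (d₀ : A → Maybe B) (d : I → A → Maybe C) (is : List I) where

  length-≤-cover : (∀ x → Is-just (d₀ x) ⊎ Any (λ i → Is-just (d i x)) is) →
    ∀ xs → length xs ≤ length (mapMaybe d₀ xs) + sum (map (λ i → length (mapMaybe (d i) xs)) is)
  length-≤-cover cover []       = z≤n
  length-≤-cover cover (x ∷ xs) with cover x
  ... | inj₁ j   = ≤-trans (s≤s (length-≤-cover cover xs))
    (+-mono-<-≤ (length-mapMaybe-∷-< d₀ x xs j)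
                (sum-map-≤ (λ i → length-mapMaybe-∷-≤ (d i) x xs) is))
  ... | inj₂ any = ≤-trans (s≤s (length-≤-cover cover xs))
    (+-mono-≤-< (length-mapMaybe-∷-≤ d₀ x xs)
                (sum-map-< (λ i → length-mapMaybe-∷-≤ (d i) x xs)
                           (Any.map (λ {i} → length-mapMaybe-∷-< (d i) x xs) any)))

module _ (a b : ℕ) where

  decodeBase : Subset (a + b) → Maybe (Subset a)
  decodeBase A with nonempty? (drop a A)
  ... | yes _ = nothing
  ... | no _  = just (take a A)

  decodeFibre : Subset a → Subset (a + b) → Maybe (Subset b)
  decodeFibre S A with ≡-dec _≟ᴮ_ (take a A) S | nonempty? (drop a A)
  ... | yes _ | yes _ = just (drop a A)
  ... | yes _ | no _  = nothing
  ... | no _  | _     = nothing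

  baseFamily : List (Subset (a + b)) → List (Subset a)
  baseFamily = mapMaybe decodeBase

  fibreFamily : Subset a → List (Subset (a + b)) → List (Subset b)
  fibreFamily S = mapMaybe (decodeFibre S)

  take++⊥ : ∀ {A : Subset (a + b)} → Empty (drop a A) → A ≡ take a A ++ ⊥
  take++⊥ {A} ¬ne = trans (sym (take++drop≡id a A)) (cong (take a A ++_) (Empty-unique ¬ne))

  decodeBase-sound : ∀ {A : Subset (a + b)} {S} → decodeBase A ≡ just S → A ≡ S ++ ⊥
  decodeBase-sound {A} eq with nonempty? (drop a A)
  decodeBase-sound {A} refl | no ¬ne = take++⊥ ¬ne

  decodeFibre-sound : ∀ {S A T} → decodeFibre S A ≡ just T → A ≡ S ++ T
  decodeFibre-sound {S} {A} eq with ≡-dec _≟ᴮ_ (take a A) S | nonempty? (drop a A)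
  decodeFibre-sound {A = A} refl | yes refl | yes _ = sym (take++drop≡id a A)

  decodeBase-nonempty : ∀ {A : Subset (a + b)} → Nonempty A → MaybeAll.All Nonempty (decodeBase A)
  decodeBase-nonempty {A} neA with nonempty? (drop a A)
  ... | yes _  = MaybeAll.nothing
  ... | no ¬ne = MaybeAll.just (Nonempty-++⊥⁻ (take a A) (subst Nonempty (take++⊥ ¬ne) neA))

  decodeFibre-nonempty : ∀ S A → MaybeAll.All Nonempty (decodeFibre S A)
  decodeFibre-nonempty S A with ≡-dec _≟ᴮ_ (take a A) S | nonempty? (drop a A)
  ... | yes _ | yes ne = MaybeAll.just ne
  ... | yes _ | no _   = MaybeAll.nothing
  ... | no _  | _      = MaybeAll.nothing

  decodeFibre-take : ∀ A → Nonempty (drop a A) → Is-just (decodeFibre (take a A) A)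
  decodeFibre-take A ne with ≡-dec _≟ᴮ_ (take a A) (take a A) | nonempty? (drop a A)
  ... | yes _  | yes _  = MaybeAny.just tt
  ... | yes _  | no ¬ne = ⊥-elim (¬ne ne)
  ... | no ¬eq | _      = ⊥-elim (¬eq refl)

  decodeBase-empty : ∀ A → Empty (drop a A) → Is-just (decodeBase A)
  decodeBase-empty A ¬ne with nonempty? (drop a A)
  ... | yes ne = ⊥-elim (¬ne ne)
  ... | no _   = MaybeAny.just tt

  decoded : ∀ A → Is-just (decodeBase A) ⊎ Any (λ S → Is-just (decodeFibre S A)) (allSubsets a)
  decoded A = byDropEmptiness (nonempty? (drop a A))
    where
    byDropEmptiness : Dec (Nonempty (drop a A)) →
      Is-just (decodeBase A) ⊎ Any (λ S → Is-just (decodeFibre S A)) (allSubsets a)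
    byDropEmptiness (yes ne) = inj₂ (Any.map (λ { refl → decodeFibre-take A ne }) (∈-allSubsets (take a A)))
    byDropEmptiness (no ¬ne) = inj₁ (decodeBase-empty A ¬ne)

  baseFamily-isUnionFreeFamily : ∀ {F} → IsUnionFreeFamily (a + b) F → IsUnionFreeFamily a (baseFamily F)
  baseFamily-isUnionFreeFamily {F} (uniqueF , nonemptyF , unionFreeF) =
      Base.mapMaybe-unique uniqueF
    , All.mapMaybe⁺ (All.map⁺ (All.map decodeBase-nonempty nonemptyF))
    , UnionFree-pullback (_++ ⊥ {b}) (++-injectiveˡ _ _) (⋃-map-++ʳ ⊥) (Base.encode-∈ F) unionFreeF
    where module Base = PartialInverse (_++ ⊥ {b}) decodeBase decodeBase-sound

  fibreFamily-isUnionFreeFamily : ∀ S {F} → IsUnionFreeFamily (a + b) F → IsUnionFreeFamily b (fibreFamily S F)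
  fibreFamily-isUnionFreeFamily S {F} (uniqueF , _ , unionFreeF) =
      Fibre.mapMaybe-unique uniqueF
    , All.mapMaybe⁺ (All.map⁺ (All.universal (decodeFibre-nonempty S) F))
    , UnionFree-pullback (S ++_) (++-injectiveʳ S S) (⋃-map-++ˡ S) (Fibre.encode-∈ F) unionFreeF
    where module Fibre = PartialInverse (S ++_) (decodeFibre S) decodeFibre-sound

  length-≤-base+fibres : ∀ F →
    length F ≤ length (baseFamily F) + sum (map (λ S → length (fibreFamily S F)) (allSubsets a))
  length-≤-base+fibres = length-≤-cover decodeBase decodeFibre (allSubsets a) decoded

M-+-≤ : ∀ a b {k k₁ k₂} → IsM (a + b) k → IsM a k₁ → IsM b k₂ → k ≤ k₁ + 2 ^ a * k₂
M-+-≤ a b {k₁ = k₁} {k₂} ((F , isUFF , refl) , _) (_ , maximalA) (_ , maximalB) = begin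
  length F
    ≤⟨ length-≤-base+fibres a b F ⟩
  length (baseFamily a b F) + sum (map (λ S → length (fibreFamily a b S F)) (allSubsets a))
    ≤⟨ +-mono-≤ (maximalA _ (baseFamily-isUnionFreeFamily a b isUFF))
                (sum-map-≤-length-* (λ S → maximalB _ (fibreFamily-isUnionFreeFamily a b S isUFF)) (allSubsets a)) ⟩
  k₁ + length (allSubsets a) * k₂
    ≡⟨ cong (λ N → k₁ + N * k₂) (length-allSubsets a) ⟩
  k₁ + 2 ^ a * k₂ ∎
  where open ≤-Reasoning

mainTheorem7 : ∀ (n n₁ n₂ k k₁ k₂ : ℕ) → 1 ≤ n₁ → 1 ≤ n₂ → n ≡ n₁ + n₂ →
    IsM n k → IsM n₁ k₁ → IsM n₂ k₂ → k ≤ k₁ + 2 ^ n₁ * k₂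
mainTheorem7 n n₁ n₂ k k₁ k₂ _ _ refl = M-+-≤ n₁ n₂
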